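{- Fix an integer $s\ge0$. As formal power series, $$\sum_{k=1}^{\infty} a_s(k)z^k \;=\; \frac{z}{1-z}+\frac{z^2}{(1-z^2)(1-z)}\sum_{i=1}^{\infty} z^{si+2^i-1}\bigl(1-z^{2^i}\bigr).$$
   Context: Fix an integer $s\ge 0$. Let $\mathcal{T}_s$ be the following infinite graph. It has super-nodes (level 0 nodes) $s_1,s_2,s_3,\dots$, with $s_{i+1}$ adjacent to $s_i$ for each $i\ge1$. Each super-node $s_i$ has $2^{i-1}$ children (level 1 nodes), called in left-to-right order the 1st, 2nd, $\dots$, $2^{i-1}$th child of $s_i$. Each level 1 node has exactly one child, a level 2 node, and level 2 nodes have no children. In addition there is one isolated node $I$. The leaves of $\mathcal{T}_s$ are the level 2 nodes together with $I$. Nodes are labelled by positive integers as follows: $I$ gets label $1$; then for $i=1,2,3,\dots$ in turn, the super-node $s_i$ receives the next $s$ consecutive unused labels (no label at all if $s=0$), and then for $r=1,2,\dots,2^{i-1}$ in turn, the $r$th child of $s_i$ receives the next unused label and then its child (a leaf) receives the next unused label. Thus each positive integer labels exactly one node. For $n\ge1$ let $v_s(n)$ be the node with label $n$, let $d_s(n)=1$ if $v_s(n)$ is a leaf and $d_s(n)=0$ otherwise, and let $a_s(n)=\sum_{k=1}^n d_s(k)$. -}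

module Defs where

open import Data.Bool using (Bool; true; false; if_then_else_)
open import Data.Nat as ℕ using (ℕ; zero; suc; _∸_; _^_; _<ᵇ_; _≡ᵇ_; _%_)
open import Data.Integer as ℤ using (ℤ; +_; _-_)

-- Label 1 is the isolated node I (a leaf).  After that, for i = 1,2,...,
-- the "block" of super-node s_i consists of 2^(i-1) children pairs plus the
-- s labels of s_i, i.e. s + 2^i consecutive labels:
--   positions 0 .. s-1        : s_i itself (not a leaf)
--   position  s + 2(r-1)      : r-th child of s_i (level 1, not a leaf)
--   position  s + 2(r-1) + 1  : its child (level 2, a leaf)

leafPos : ℕ → ℕ → Bool
leafPos s p = if p <ᵇ s then false else ((p ∸ s) % 2 ≡ᵇ 1)

-- go fuel s i m : is the m-th (0-based) label after label 1, searched
-- starting from block i, a leaf?  Fuel m+1 always suffices since blocks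
-- have size s + 2^i ≥ 2.
go : ℕ → ℕ → ℕ → ℕ → Bool
go zero    s i m = false
go (suc f) s i m =
  if m <ᵇ (s ℕ.+ 2 ^ i) then leafPos s m
  else go f s (suc i) (m ∸ (s ℕ.+ 2 ^ i))

-- d s n = d_s(n) (as a Bool: true iff the node labelled n is a leaf)
d : ℕ → ℕ → Bool
d s zero          = false   -- label 0 does not exist; never used
d s (suc zero)    = true
d s (suc (suc k)) = go (suc k) s 1 k

toℕ : Bool → ℕ
toℕ true  = 1
toℕ false = 0

a : ℕ → ℕ → ℕ
a s zero    = 0
a s (suc n) = a s n ℕ.+ toℕ (d s (suc n))

FPS : Set
FPS = ℕ → ℤ

sumTo : ℕ → (ℕ → ℤ) → ℤ
sumTo zero    f = f 0
sumTo (suc n) f = sumTo n f ℤ.+ f (suc n)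

_⊕_ : FPS → FPS → FPS
(f ⊕ g) n = f n ℤ.+ g n

_⊖_ : FPS → FPS → FPS
(f ⊖ g) n = f n - g n

_⊗_ : FPS → FPS → FPS
(f ⊗ g) n = sumTo n (λ k → f k ℤ.* g (n ∸ k))

infixl 6 _⊕_ _⊖_
infixl 7 _⊗_

Z^ : ℕ → FPS
Z^ m n = if m ≡ᵇ n then + 1 else + 0

-- 1/(1 - z^m) for m ≥ 1 (written with m = suc k): the geometric series
-- Σ_j z^{mj}, the multiplicative inverse of 1 - z^m in ℤ[[z]].
geomInv : ℕ → FPS
geomInv k n = if n % suc k ≡ᵇ 0 then + 1 else + 0

-- Infinite sum Σ_{i≥1} F i of a family with ord(F i) ≥ i (so that the
-- family is summable): the n-th coefficient is the finite sum over
-- i = 1 .. n (all later terms contribute 0 to coefficient n).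
Σ≥1 : (ℕ → FPS) → FPS
Σ≥1 F n = sumTo n (λ i → if i ≡ᵇ 0 then + 0 else F i n)

LHS : ℕ → FPS
LHS s zero    = + 0
LHS s (suc k) = + a s (suc k)

-- z^{s i + 2^i - 1} (1 - z^{2^i}),  which has order ≥ i
term : ℕ → ℕ → FPS
term s i = Z^ (s ℕ.* i ℕ.+ 2 ^ i ∸ 1) ⊗ (Z^ 0 ⊖ Z^ (2 ^ i))

RHS : ℕ → FPS
RHS s = Z^ 1 ⊗ geomInv 0
      ⊕ Z^ 2 ⊗ geomInv 1 ⊗ geomInv 0 ⊗ Σ≥1 (term s)

module Submission where

open import Defs
open import Data.Nat using (ℕ)
open import Relation.Binary.PropositionalEquality using (_≡_)

-- The labels after label 1 (the
-- node I) come in blocks: block i ≥ 1 holds the s labels of s_i, then 2^i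
-- labels alternating child/leaf.  Block i ends right after label E s i + 2^i,
-- and its leaves among the labels 1..n number
--   leavesIn s i n = ⌊(n - E s i)/2⌋ - ⌊(n - E s i - 2^i)/2⌋   (truncated).
--  * PowerSeries: Cauchy-product algebra shows that the n-th coefficient of
--    the right side is [n ≥ 1] plus the sum over i of exactly this quantity,
--    since z^2/((1-z^2)(1-z)) = Σ ⌊n/2⌋ z^n.
--  * Counting: following the recursion of 'go' block by block, a_s(n) is 1
--    plus the sum over i of leavesIn s i n.
--  * Comparison matches the two sums, and the theorem follows.

open import Data.Nat using (zero; suc)
import Data.Nat as ℕ
import Data.Nat.Properties as ℕP
import Data.Integer as ℤ
import Data.Integer.Properties as ℤP
open import Relation.Binary.PropositionalEquality using (refl; sym; cong; cong₂; module ≡-Reasoning)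

E : ℕ → ℕ → ℕ
E s i = s ℕ.* i ℕ.+ 2 ℕ.^ i ℕ.∸ 1

module PowerSeries where

  open import Data.Bool using (if_then_else_)
  open import Data.Nat using (zero; suc; _∸_; _^_; _≤_; _<_; z≤n; s≤s; ⌊_/2⌋)
  open import Data.Nat.DivMod using (n%1≡0)
  open import Data.Integer using (ℤ; +_; _+_; _*_; -_; _-_)
  open import Data.Integer.Tactic.RingSolver using (solve-∀)
  open import Data.Sum using (inj₁; inj₂)
  open import Relation.Binary.PropositionalEquality using (refl; trans)
  open import Relation.Nullary using (¬_)
  open import Data.Empty using (⊥-elim)

  sumTo-cong : ∀ n {f g : ℕ → ℤ} → (∀ k → k ≤ n → f k ≡ g k) → sumTo n f ≡ sumTo n g
  sumTo-cong zero    f≗g = f≗g 0 z≤n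
  sumTo-cong (suc n) f≗g =
    cong₂ _+_ (sumTo-cong n (λ k k≤n → f≗g k (ℕP.m≤n⇒m≤1+n k≤n))) (f≗g (suc n) ℕP.≤-refl)

  sumTo-zero : ∀ n (f : ℕ → ℤ) → (∀ k → k ≤ n → f k ≡ + 0) → sumTo n f ≡ + 0
  sumTo-zero zero    f f≗0 = f≗0 0 z≤n
  sumTo-zero (suc n) f f≗0 =
    cong₂ _+_ (sumTo-zero n f (λ k k≤n → f≗0 k (ℕP.m≤n⇒m≤1+n k≤n))) (f≗0 (suc n) ℕP.≤-refl)

  sumTo-+ : ∀ n (f g : ℕ → ℤ) → sumTo n (λ k → f k + g k) ≡ sumTo n f + sumTo n g
  sumTo-+ zero    f g = refl
  sumTo-+ (suc n) f g = trans (cong (_+ (f (suc n) + g (suc n))) (sumTo-+ n f g))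
                              (interchange (sumTo n f) (sumTo n g) (f (suc n)) (g (suc n)))
    where
    interchange : ∀ a b c d → (a + b) + (c + d) ≡ (a + c) + (b + d)
    interchange = solve-∀

  sumTo-neg : ∀ n (f : ℕ → ℤ) → sumTo n (λ k → - f k) ≡ - sumTo n f
  sumTo-neg zero    f = refl
  sumTo-neg (suc n) f = trans (cong (_+ - f (suc n)) (sumTo-neg n f))
                              (sym (ℤP.neg-distrib-+ (sumTo n f) (f (suc n))))

  sumTo-*ˡ : ∀ n c (f : ℕ → ℤ) → sumTo n (λ k → c * f k) ≡ c * sumTo n f
  sumTo-*ˡ zero    c f = refl
  sumTo-*ˡ (suc n) c f = trans (cong (_+ c * f (suc n)) (sumTo-*ˡ n c f))
                               (sym (ℤP.*-distribˡ-+ c (sumTo n f) (f (suc n))))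

  sumTo-front : ∀ n (f : ℕ → ℤ) → sumTo (suc n) f ≡ f 0 + sumTo n (λ k → f (suc k))
  sumTo-front zero    f = refl
  sumTo-front (suc n) f = trans (cong (_+ f (suc (suc n))) (sumTo-front n f))
                                (ℤP.+-assoc (f 0) _ _)

  sumTo-reverse : ∀ n (f : ℕ → ℤ) → sumTo n f ≡ sumTo n (λ k → f (n ∸ k))
  sumTo-reverse zero    f = refl
  sumTo-reverse (suc n) f = begin
    sumTo n f + f (suc n)                    ≡⟨ ℤP.+-comm (sumTo n f) _ ⟩
    f (suc n) + sumTo n f                    ≡⟨ cong (_+_ (f (suc n))) (sumTo-reverse n f) ⟩
    f (suc n) + sumTo n (λ k → f (n ∸ k))    ≡⟨ sym (sumTo-front n (λ k → f (suc n ∸ k))) ⟩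
    sumTo (suc n) (λ k → f (suc n ∸ k))      ∎
    where open ≡-Reasoning

  sumTo-swap : ∀ n m (F : ℕ → ℕ → ℤ) →
               sumTo n (λ k → sumTo m (F k)) ≡ sumTo m (λ i → sumTo n (λ k → F k i))
  sumTo-swap zero    m F = refl
  sumTo-swap (suc n) m F = trans (cong (_+ sumTo m (F (suc n))) (sumTo-swap n m F))
                                 (sym (sumTo-+ m (λ i → sumTo n (λ k → F k i)) (F (suc n))))

  sumTo-extend : ∀ {n m} (f : ℕ → ℤ) → n ≤ m → (∀ k → n < k → f k ≡ + 0) → sumTo n f ≡ sumTo m f
  sumTo-extend {n} {m} f n≤m f≗0 with ℕP.m≤n⇒m<n∨m≡n n≤m
  ... | inj₂ refl = refl
  ... | inj₁ n<m@(s≤s {n = m'} n≤m') = begin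
    sumTo n f           ≡⟨ sumTo-extend f n≤m' f≗0 ⟩
    sumTo m' f          ≡⟨ sym (ℤP.+-identityʳ _) ⟩
    sumTo m' f + + 0    ≡⟨ cong (_+_ (sumTo m' f)) (sym (f≗0 (suc m') n<m)) ⟩
    sumTo (suc m') f    ∎
    where open ≡-Reasoning

  Z^-diag : ∀ m → Z^ m m ≡ + 1
  Z^-diag zero    = refl
  Z^-diag (suc m) = Z^-diag m

  Z^-off : ∀ m k → ¬ m ≡ k → Z^ m k ≡ + 0
  Z^-off zero    zero    m≢k = ⊥-elim (m≢k refl)
  Z^-off zero    (suc k) m≢k = refl
  Z^-off (suc m) zero    m≢k = refl
  Z^-off (suc m) (suc k) m≢k = Z^-off m k (λ m≡k → m≢k (cong suc m≡k))

  Z^-below : ∀ {m k} → k < m → Z^ m k ≡ + 0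
  Z^-below k<m = Z^-off _ _ (λ m≡k → ℕP.<⇒≢ k<m (sym m≡k))

  Z^-shift : ∀ e a j → Z^ (e ℕ.+ a) (e ℕ.+ j) ≡ Z^ a j
  Z^-shift zero    a j = refl
  Z^-shift (suc e) a j = Z^-shift e a j

  sumTo-Z^-below : ∀ n m (g : ℕ → ℤ) → n < m → sumTo n (λ k → Z^ m k * g k) ≡ + 0
  sumTo-Z^-below n m g n<m =
    sumTo-zero n _ (λ k k≤n → cong (_* g k) (Z^-below {m} {k} (ℕP.≤-<-trans k≤n n<m)))

  sumTo-Z^ : ∀ n m (g : ℕ → ℤ) → m ≤ n → sumTo n (λ k → Z^ m k * g k) ≡ g m
  sumTo-Z^ zero    zero g z≤n  = ℤP.*-identityˡ (g 0)
  sumTo-Z^ (suc n) m    g m≤1+n with ℕP.m≤n⇒m<n∨m≡n m≤1+n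
  ... | inj₁ (s≤s m≤n) = begin
    sumTo n (λ k → Z^ m k * g k) + Z^ m (suc n) * g (suc n)
      ≡⟨ cong₂ _+_ (sumTo-Z^ n m g m≤n) (cong (_* g (suc n)) (Z^-off m (suc n) (ℕP.<⇒≢ (s≤s m≤n)))) ⟩
    g m + + 0 * g (suc n)
      ≡⟨ ℤP.+-identityʳ (g m) ⟩
    g m ∎
    where open ≡-Reasoning
  ... | inj₂ refl = begin
    sumTo n (λ k → Z^ m k * g k) + Z^ m m * g m
      ≡⟨ cong₂ _+_ (sumTo-Z^-below n m g ℕP.≤-refl) (cong (_* g m) (Z^-diag m)) ⟩
    + 0 + + 1 * g m
      ≡⟨ trans (ℤP.+-identityˡ _) (ℤP.*-identityˡ (g m)) ⟩
    g m ∎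
    where open ≡-Reasoning

  Z^⊗ : ∀ m f n → m ≤ n → (Z^ m ⊗ f) n ≡ f (n ∸ m)
  Z^⊗ m f n = sumTo-Z^ n m (λ k → f (n ∸ k))

  Z^⊗-below : ∀ m f n → n < m → (Z^ m ⊗ f) n ≡ + 0
  Z^⊗-below m f n = sumTo-Z^-below n m (λ k → f (n ∸ k))

  ⊗-comm : ∀ f g n → (f ⊗ g) n ≡ (g ⊗ f) n
  ⊗-comm f g n = begin
    sumTo n (λ k → f k * g (n ∸ k))              ≡⟨ sumTo-reverse n _ ⟩
    sumTo n (λ k → f (n ∸ k) * g (n ∸ (n ∸ k)))  ≡⟨ sumTo-cong n swapped ⟩
    sumTo n (λ k → g k * f (n ∸ k))              ∎
    where
    open ≡-Reasoning
    swapped : ∀ k → k ≤ n → f (n ∸ k) * g (n ∸ (n ∸ k)) ≡ g k * f (n ∸ k)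
    swapped k k≤n = trans (cong (λ j → f (n ∸ k) * g j) (ℕP.m∸[m∸n]≡n k≤n))
                          (ℤP.*-comm (f (n ∸ k)) (g k))

  ⊗-congʳ : ∀ f {g h} → (∀ m → g m ≡ h m) → ∀ n → (f ⊗ g) n ≡ (f ⊗ h) n
  ⊗-congʳ f g≗h n = sumTo-cong n (λ k _ → cong (f k *_) (g≗h (n ∸ k)))

  ⊗-⊖ : ∀ f g h n → (f ⊗ (g ⊖ h)) n ≡ (f ⊗ g) n - (f ⊗ h) n
  ⊗-⊖ f g h n = begin
    sumTo n (λ k → f k * (g (n ∸ k) - h (n ∸ k)))
      ≡⟨ sumTo-cong n (λ k _ → distrib (f k) (g (n ∸ k)) (h (n ∸ k))) ⟩
    sumTo n (λ k → f k * g (n ∸ k) + - (f k * h (n ∸ k)))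
      ≡⟨ sumTo-+ n _ _ ⟩
    (f ⊗ g) n + sumTo n (λ k → - (f k * h (n ∸ k)))
      ≡⟨ cong (_+_ ((f ⊗ g) n)) (sumTo-neg n _) ⟩
    (f ⊗ g) n - (f ⊗ h) n ∎
    where
    open ≡-Reasoning
    distrib : ∀ c a b → c * (a - b) ≡ c * a + - (c * b)
    distrib = solve-∀

  Z^⊗Z^ : ∀ a b n → (Z^ a ⊗ Z^ b) n ≡ Z^ (a ℕ.+ b) n
  Z^⊗Z^ a b n with ℕP.≤-<-connex a n
  ... | inj₁ a≤n = trans (Z^⊗ a (Z^ b) n a≤n)
                         (trans (sym (Z^-shift a b (n ∸ a)))
                                (cong (Z^ (a ℕ.+ b)) (ℕP.m+[n∸m]≡n a≤n)))
  ... | inj₂ n<a = trans (Z^⊗-below a (Z^ b) n n<a)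
                         (sym (Z^-below {a ℕ.+ b} {n} (ℕP.<-≤-trans n<a (ℕP.m≤m+n a b))))

  ⊗Z^ : ∀ f m n → f 0 ≡ + 0 → (f ⊗ Z^ m) n ≡ f (n ∸ m)
  ⊗Z^ f m n f0≡0 with ℕP.≤-<-connex m n
  ... | inj₁ m≤n = trans (⊗-comm f (Z^ m) n) (Z^⊗ m f n m≤n)
  ... | inj₂ n<m = begin
    (f ⊗ Z^ m) n  ≡⟨ ⊗-comm f (Z^ m) n ⟩
    (Z^ m ⊗ f) n  ≡⟨ Z^⊗-below m f n n<m ⟩
    + 0           ≡⟨ sym f0≡0 ⟩
    f 0           ≡⟨ cong f (sym (ℕP.m≤n⇒m∸n≡0 (ℕP.<⇒≤ n<m))) ⟩
    f (n ∸ m)     ∎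
    where open ≡-Reasoning

  geomInv0 : ∀ j → geomInv 0 j ≡ + 1
  geomInv0 j rewrite n%1≡0 j = refl

  ⊗geom : ∀ f n → (f ⊗ geomInv 0) n ≡ sumTo n f
  ⊗geom f n = sumTo-cong n (λ k _ → trans (cong (f k *_) (geomInv0 (n ∸ k))) (ℤP.*-identityʳ (f k)))

  ⊗-Σ≥1 : ∀ h (F : ℕ → FPS) → (∀ i m → m < i → F i m ≡ + 0) →
          ∀ n → (h ⊗ Σ≥1 F) n ≡ Σ≥1 (λ i → h ⊗ F i) n
  ⊗-Σ≥1 h F ord n = begin
    sumTo n (λ k → h k * sumTo (n ∸ k) (F′ (n ∸ k)))
      ≡⟨ sumTo-cong n (λ k _ → cong (h k *_) (sumTo-extend (F′ (n ∸ k)) (ℕP.m∸n≤m n k) (F′-vanishes (n ∸ k)))) ⟩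
    sumTo n (λ k → h k * sumTo n (F′ (n ∸ k)))
      ≡⟨ sumTo-cong n (λ k _ → sym (sumTo-*ˡ n (h k) (F′ (n ∸ k)))) ⟩
    sumTo n (λ k → sumTo n (λ i → h k * F′ (n ∸ k) i))
      ≡⟨ sumTo-swap n n _ ⟩
    sumTo n (λ i → sumTo n (λ k → h k * F′ (n ∸ k) i))
      ≡⟨ sumTo-cong n (λ i _ → pull i) ⟩
    Σ≥1 (λ i → h ⊗ F i) n ∎
    where
    open ≡-Reasoning
    F′ : ℕ → ℕ → ℤ
    F′ m i = if i ℕ.≡ᵇ 0 then + 0 else F i m
    F′-vanishes : ∀ m i → m < i → F′ m i ≡ + 0
    F′-vanishes m (suc i) m<i = ord (suc i) m m<i
    pull : ∀ i → sumTo n (λ k → h k * F′ (n ∸ k) i) ≡ (if i ℕ.≡ᵇ 0 then + 0 else (h ⊗ F i) n)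
    pull zero    = sumTo-zero n _ (λ k _ → ℤP.*-zeroʳ (h k))
    pull (suc i) = refl

  z/[1-z] : ∀ n → (Z^ 1 ⊗ geomInv 0) (suc n) ≡ + 1
  z/[1-z] n = trans (Z^⊗ 1 (geomInv 0) (suc n) (s≤s z≤n)) (geomInv0 n)

  evenPowers : FPS
  evenPowers = Z^ 2 ⊗ geomInv 1

  evenPowers-pair : ∀ n → evenPowers (suc n) + evenPowers (suc (suc n)) ≡ + 1
  evenPowers-pair zero    = cong₂ _+_ (Z^⊗-below 2 (geomInv 1) 1 ℕP.≤-refl) (Z^⊗ 2 (geomInv 1) 2 ℕP.≤-refl)
  evenPowers-pair (suc n) = trans (cong₂ _+_ (Z^⊗ 2 (geomInv 1) (2 ℕ.+ n) (ℕP.m≤m+n 2 n))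
                                             (Z^⊗ 2 (geomInv 1) (3 ℕ.+ n) (ℕP.m≤m+n 2 (suc n))))
                                  (geomInv1-pair n)
    where
    geomInv1-pair : ∀ j → geomInv 1 j + geomInv 1 (suc j) ≡ + 1
    geomInv1-pair zero    = refl
    geomInv1-pair (suc j) = trans (ℤP.+-comm (geomInv 1 (suc j)) (geomInv 1 j)) (geomInv1-pair j)

  halfSeries : ∀ n → (Z^ 2 ⊗ geomInv 1 ⊗ geomInv 0) n ≡ + ⌊ n /2⌋
  halfSeries n = trans (⊗geom evenPowers n) (partialSums n)
    where
    partialSums : ∀ n → sumTo n evenPowers ≡ + ⌊ n /2⌋
    partialSums zero          = refl
    partialSums (suc zero)    = refl
    partialSums (suc (suc n)) = begin
      (sumTo n evenPowers + evenPowers (suc n)) + evenPowers (suc (suc n))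
        ≡⟨ ℤP.+-assoc (sumTo n evenPowers) _ _ ⟩
      sumTo n evenPowers + (evenPowers (suc n) + evenPowers (suc (suc n)))
        ≡⟨ cong₂ _+_ (partialSums n) (evenPowers-pair n) ⟩
      + ⌊ n /2⌋ + + 1
        ≡⟨ cong +_ (ℕP.+-comm ⌊ n /2⌋ 1) ⟩
      + ⌊ suc (suc n) /2⌋ ∎
      where open ≡-Reasoning

  i<2^i : ∀ i → i < 2 ^ i
  i<2^i zero    = s≤s z≤n
  i<2^i (suc i) = ℕP.+-mono-≤-< (ℕP.≤-trans (s≤s z≤n) (i<2^i i)) (ℕP.<-≤-trans (i<2^i i) (ℕP.m≤m+n (2 ^ i) 0))

  i≤E : ∀ s i → i ≤ E s i
  i≤E s i = ℕP.≤-trans (ℕP.∸-monoˡ-≤ 1 (i<2^i i)) (ℕP.∸-monoˡ-≤ 1 (ℕP.m≤n+m (2 ^ i) (s ℕ.* i)))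

  term-coeff : ∀ s i m → term s i m ≡ Z^ (E s i) m - Z^ (E s i ℕ.+ 2 ^ i) m
  term-coeff s i m = trans (⊗-⊖ (Z^ (E s i)) (Z^ 0) (Z^ (2 ^ i)) m)
    (cong₂ _-_ (trans (Z^⊗Z^ (E s i) 0 m) (cong (λ e → Z^ e m) (ℕP.+-identityʳ (E s i))))
               (Z^⊗Z^ (E s i) (2 ^ i) m))

  term-order : ∀ s i m → m < i → term s i m ≡ + 0
  term-order s i m m<i = Z^⊗-below (E s i) (Z^ 0 ⊖ Z^ (2 ^ i)) m (ℕP.<-≤-trans m<i (i≤E s i))

  halfSeries⊗term : ∀ s i n → (Z^ 2 ⊗ geomInv 1 ⊗ geomInv 0 ⊗ term s i) n
                            ≡ + ⌊ n ∸ E s i /2⌋ - + ⌊ n ∸ (E s i ℕ.+ 2 ^ i) /2⌋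
  halfSeries⊗term s i n = begin
    (H ⊗ term s i) n
      ≡⟨ ⊗-congʳ H (term-coeff s i) n ⟩
    (H ⊗ (Z^ (E s i) ⊖ Z^ (E s i ℕ.+ 2 ^ i))) n
      ≡⟨ ⊗-⊖ H (Z^ (E s i)) (Z^ (E s i ℕ.+ 2 ^ i)) n ⟩
    (H ⊗ Z^ (E s i)) n - (H ⊗ Z^ (E s i ℕ.+ 2 ^ i)) n
      ≡⟨ cong₂ _-_ (⊗Z^ H (E s i) n (halfSeries 0)) (⊗Z^ H (E s i ℕ.+ 2 ^ i) n (halfSeries 0)) ⟩
    H (n ∸ E s i) - H (n ∸ (E s i ℕ.+ 2 ^ i))
      ≡⟨ cong₂ _-_ (halfSeries (n ∸ E s i)) (halfSeries (n ∸ (E s i ℕ.+ 2 ^ i))) ⟩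
    + ⌊ n ∸ E s i /2⌋ - + ⌊ n ∸ (E s i ℕ.+ 2 ^ i) /2⌋ ∎
    where
    open ≡-Reasoning
    H : FPS
    H = Z^ 2 ⊗ geomInv 1 ⊗ geomInv 0

  RHS-expand : ∀ s n → RHS s n ≡ (Z^ 1 ⊗ geomInv 0) n + Σ≥1 (λ i → Z^ 2 ⊗ geomInv 1 ⊗ geomInv 0 ⊗ term s i) n
  RHS-expand s n = cong (_+_ ((Z^ 1 ⊗ geomInv 0) n)) (⊗-Σ≥1 (Z^ 2 ⊗ geomInv 1 ⊗ geomInv 0) (term s) (term-order s) n)

module Counting where

  open import Data.Bool using (true; false; if_then_else_)
  open import Data.Empty using (⊥-elim)
  open import Data.Unit using (tt)
  open import Data.Nat using (zero; suc; _+_; _*_; _∸_; _^_; _≤_; _<_; _<?_; s≤s; _%_; _≡ᵇ_; _<ᵇ_; ⌊_/2⌋)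
  open import Data.Nat.Tactic.RingSolver using (solve-∀)
  open import Relation.Binary.PropositionalEquality using (refl; trans)
  open import Relation.Nullary using (¬_; yes; no)

  if-< : ∀ {A : Set} {m n} (x y : A) → m < n → (if m <ᵇ n then x else y) ≡ x
  if-< {m = m} {n} x y m<n with m <ᵇ n | ℕP.<⇒<ᵇ m<n
  ... | true | _ = refl

  if-≮ : ∀ {A : Set} {m n} (x y : A) → ¬ m < n → (if m <ᵇ n then x else y) ≡ y
  if-≮ {m = m} {n} x y m≮n with m <ᵇ n | ℕP.<ᵇ⇒< m n
  ... | false | _        = refl
  ... | true  | true⇒m<n = ⊥-elim (m≮n (true⇒m<n tt))

  -- Leaves inside one block.  Among the first y labels that follow the s labels
  -- of a super-node with P children, every second one is a leaf, up to P labels.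
  leafCount : ℕ → ℕ → ℕ
  leafCount P y = ⌊ y /2⌋ ∸ ⌊ y ∸ P /2⌋

  leafCount-below : ∀ P y → y ≤ P → leafCount P y ≡ ⌊ y /2⌋
  leafCount-below P y y≤P = cong (λ x → ⌊ y /2⌋ ∸ ⌊ x /2⌋) (ℕP.m≤n⇒m∸n≡0 y≤P)

  leafCount-zero : ∀ P → leafCount P 0 ≡ 0
  leafCount-zero P = ℕP.0∸n≡0 ⌊ 0 ∸ P /2⌋

  ⌊1+y/2⌋ : ∀ y → ⌊ suc y /2⌋ ≡ ⌊ y /2⌋ + toℕ (y % 2 ≡ᵇ 1)
  ⌊1+y/2⌋ zero          = refl
  ⌊1+y/2⌋ (suc zero)    = refl
  ⌊1+y/2⌋ (suc (suc y)) = cong suc (⌊1+y/2⌋ y)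

  ⌊2h+y/2⌋ : ∀ h y → ⌊ 2 * h + y /2⌋ ≡ h + ⌊ y /2⌋
  ⌊2h+y/2⌋ zero    y = refl
  ⌊2h+y/2⌋ (suc h) y rewrite ℕP.+-suc h (h + 0) = cong suc (⌊2h+y/2⌋ h y)

  leafCount-full : ∀ h y → 2 * h ≤ y → leafCount (2 * h) y ≡ h
  leafCount-full h y 2h≤y = begin
    ⌊ y /2⌋ ∸ ⌊ y ∸ 2 * h /2⌋                     ≡⟨ cong (λ x → ⌊ x /2⌋ ∸ ⌊ x ∸ 2 * h /2⌋) (sym y≡2h+r) ⟩
    ⌊ 2 * h + r /2⌋ ∸ ⌊ 2 * h + r ∸ 2 * h /2⌋     ≡⟨ cong₂ (λ u v → u ∸ ⌊ v /2⌋) (⌊2h+y/2⌋ h r) (ℕP.m+n∸m≡n (2 * h) r) ⟩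
    h + ⌊ r /2⌋ ∸ ⌊ r /2⌋                          ≡⟨ ℕP.m+n∸n≡m h ⌊ r /2⌋ ⟩
    h                                              ∎
    where
    open ≡-Reasoning
    r = y ∸ 2 * h
    y≡2h+r : 2 * h + r ≡ y
    y≡2h+r = ℕP.m+[n∸m]≡n 2h≤y

  leafCount-step : ∀ s P p → p < s + P → leafCount P (suc p ∸ s) ≡ leafCount P (p ∸ s) + toℕ (leafPos s p)
  leafCount-step s P p p<s+P with p <? s
  ... | yes p<s = begin
    leafCount P (suc p ∸ s)                  ≡⟨ cong (leafCount P) (trans (ℕP.m≤n⇒m∸n≡0 p<s) (sym (ℕP.m≤n⇒m∸n≡0 (ℕP.<⇒≤ p<s)))) ⟩
    leafCount P (p ∸ s)                      ≡⟨ sym (ℕP.+-identityʳ _) ⟩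
    leafCount P (p ∸ s) + toℕ false          ≡⟨ cong (λ b → leafCount P (p ∸ s) + toℕ b) (sym (if-< false _ p<s)) ⟩
    leafCount P (p ∸ s) + toℕ (leafPos s p)  ∎
    where open ≡-Reasoning
  ... | no p≮s = begin
    leafCount P (suc p ∸ s)                  ≡⟨ cong (leafCount P) (ℕP.+-∸-assoc 1 s≤p) ⟩
    leafCount P (suc y)                      ≡⟨ leafCount-below P (suc y) y<P ⟩
    ⌊ suc y /2⌋                              ≡⟨ ⌊1+y/2⌋ y ⟩
    ⌊ y /2⌋ + toℕ (y % 2 ≡ᵇ 1)               ≡⟨ cong₂ (λ c b → c + toℕ b) (sym (leafCount-below P y (ℕP.<⇒≤ y<P))) (sym (if-≮ false _ p≮s)) ⟩
    leafCount P y + toℕ (leafPos s p)        ∎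
    where
    open ≡-Reasoning
    s≤p = ℕP.≮⇒≥ p≮s
    y = p ∸ s
    y<P : y < P
    y<P = ℕP.+-cancelˡ-< s y P (ℕP.≤-trans (ℕP.≤-reflexive (cong suc (ℕP.m+[n∸m]≡n s≤p))) p<s+P)

  -- Block i ≥ 1 consists of the s labels of s_i followed by its
  -- 2^i/2 children and their leaves, 2^i labels alternating non-leaf/leaf.
  -- labelsBefore s i is the number of labels preceding block i.
  labelsBefore : ℕ → ℕ → ℕ
  labelsBefore s zero          = 0   -- there is no block 0
  labelsBefore s (suc zero)    = 1
  labelsBefore s (suc (suc i)) = labelsBefore s (suc i) + (s + 2 ^ suc i)

  -- E s i counts the labels up to and including those of the super-node s_i.
  1+E : ∀ s i → suc (E s i) ≡ s * i + 2 ^ i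
  1+E s i = trans (ℕP.+-comm 1 (E s i)) (ℕP.m∸n+n≡m (ℕP.≤-trans (ℕP.m≤n+m 1 (s * i)) (ℕP.+-monoʳ-≤ (s * i) 1≤2^i)))
    where
    1≤2^i : 1 ≤ 2 ^ i
    1≤2^i = ℕP.m^n>0 2 i

  E-labels : ∀ s i → E s (suc i) ≡ labelsBefore s (suc i) + s
  E-labels s zero    = ℕP.suc-injective (trans (1+E s 1) (base s))
    where
    base : ∀ s → s * 1 + 2 ≡ suc (suc s)
    base = solve-∀
  E-labels s (suc i) = ℕP.suc-injective (begin
    suc (E s (suc (suc i)))                       ≡⟨ 1+E s (suc (suc i)) ⟩
    s * suc (suc i) + 2 * 2 ^ suc i               ≡⟨ double s (suc i) (2 ^ suc i) ⟩
    (s * suc i + 2 ^ suc i) + (s + 2 ^ suc i)     ≡⟨ cong (_+ (s + 2 ^ suc i)) (sym (1+E s (suc i))) ⟩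
    suc (E s (suc i)) + (s + 2 ^ suc i)           ≡⟨ cong (λ e → suc e + (s + 2 ^ suc i)) (E-labels s i) ⟩
    suc (labelsBefore s (suc i) + s) + (s + 2 ^ suc i) ≡⟨ cong suc (rearrange (labelsBefore s (suc i)) s (2 ^ suc i)) ⟩
    suc (labelsBefore s (suc (suc i)) + s)        ∎)
    where
    open ≡-Reasoning
    double : ∀ s i p → s * suc i + 2 * p ≡ (s * i + p) + (s + p)
    double = solve-∀
    rearrange : ∀ L s p → (L + s) + (s + p) ≡ (L + (s + p)) + s
    rearrange = solve-∀

  leavesIn : ℕ → ℕ → ℕ → ℕ
  leavesIn s i n = leafCount (2 ^ i) (n ∸ E s i)

  leavesIn-block : ∀ s i x → leavesIn s (suc i) (labelsBefore s (suc i) + x) ≡ leafCount (2 ^ suc i) (x ∸ s)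
  leavesIn-block s i x = cong (leafCount (2 ^ suc i))
    (trans (cong (labelsBefore s (suc i) + x ∸_) (E-labels s i)) (ℕP.[m+n]∸[m+o]≡n∸o (labelsBefore s (suc i)) x s))

  leavesFrom : ℕ → ℕ → ℕ → ℕ → ℕ
  leavesFrom s zero    i n = 0
  leavesFrom s (suc g) i n = leavesIn s i n + leavesFrom s g (suc i) n

  leavesFrom-before : ∀ s g i n → n ≤ labelsBefore s (suc i) → leavesFrom s g (suc i) n ≡ 0
  leavesFrom-before s zero    i n n≤L = refl
  leavesFrom-before s (suc g) i n n≤L =
    cong₂ _+_ leavesIn-before (leavesFrom-before s g (suc i) n (ℕP.≤-trans n≤L (ℕP.m≤m+n _ _)))
    where
    n≤E : n ≤ E s (suc i)
    n≤E = ℕP.≤-trans n≤L (ℕP.≤-trans (ℕP.m≤m+n _ s) (ℕP.≤-reflexive (sym (E-labels s i))))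
    leavesIn-before : leavesIn s (suc i) n ≡ 0
    leavesIn-before = trans (cong (leafCount (2 ^ suc i)) (ℕP.m≤n⇒m∸n≡0 n≤E)) (leafCount-zero (2 ^ suc i))

  leavesIn-inside : ∀ s i m → m < s + 2 ^ suc i →
    leavesIn s (suc i) (suc (labelsBefore s (suc i) + m))
      ≡ leavesIn s (suc i) (labelsBefore s (suc i) + m) + toℕ (leafPos s m)
  leavesIn-inside s i m inBlock = begin
    leavesIn s (suc i) (suc (L + m))                ≡⟨ cong (leavesIn s (suc i)) (sym (ℕP.+-suc L m)) ⟩
    leavesIn s (suc i) (L + suc m)                  ≡⟨ leavesIn-block s i (suc m) ⟩
    leafCount (2 ^ suc i) (suc m ∸ s)               ≡⟨ leafCount-step s (2 ^ suc i) m inBlock ⟩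
    leafCount (2 ^ suc i) (m ∸ s) + toℕ (leafPos s m) ≡⟨ cong (_+ toℕ (leafPos s m)) (sym (leavesIn-block s i m)) ⟩
    leavesIn s (suc i) (L + m) + toℕ (leafPos s m)  ∎
    where
    open ≡-Reasoning
    L = labelsBefore s (suc i)

  leavesIn-complete : ∀ s i m → s + 2 ^ suc i ≤ m →
    leavesIn s (suc i) (suc (labelsBefore s (suc i) + m)) ≡ leavesIn s (suc i) (labelsBefore s (suc i) + m)
  leavesIn-complete s i m B≤m = begin
    leavesIn s (suc i) (suc (L + m))   ≡⟨ cong (leavesIn s (suc i)) (sym (ℕP.+-suc L m)) ⟩
    leavesIn s (suc i) (L + suc m)     ≡⟨ leavesIn-block s i (suc m) ⟩
    leafCount (2 * 2 ^ i) (suc m ∸ s)  ≡⟨ leafCount-full (2 ^ i) (suc m ∸ s) (ℕP.≤-trans P≤m∸s (ℕP.∸-monoˡ-≤ s (ℕP.n≤1+n m))) ⟩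
    2 ^ i                              ≡⟨ sym (leafCount-full (2 ^ i) (m ∸ s) P≤m∸s) ⟩
    leafCount (2 * 2 ^ i) (m ∸ s)      ≡⟨ sym (leavesIn-block s i m) ⟩
    leavesIn s (suc i) (L + m)         ∎
    where
    open ≡-Reasoning
    L = labelsBefore s (suc i)
    P≤m∸s : 2 ^ suc i ≤ m ∸ s
    P≤m∸s = ℕP.≤-trans (ℕP.≤-reflexive (sym (ℕP.m+n∸m≡n s (2 ^ suc i)))) (ℕP.∸-monoˡ-≤ s B≤m)

  leavesFrom-step : ∀ s f g i m → m < f → m < g →
    leavesFrom s g (suc i) (suc (labelsBefore s (suc i) + m))
      ≡ leavesFrom s g (suc i) (labelsBefore s (suc i) + m) + toℕ (go f s (suc i) m)
  leavesFrom-step s (suc f) (suc g) i m (s≤s m≤f) (s≤s m≤g) with m <? s + 2 ^ suc i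
  ... | yes inBlock = begin
    leavesIn s (suc i) (suc (L + m)) + leavesFrom s g (suc (suc i)) (suc (L + m))
      ≡⟨ cong₂ _+_ (leavesIn-inside s i m inBlock) (trans laterBlocksEmpty (sym laterBlocksEmpty′)) ⟩
    (leavesIn s (suc i) (L + m) + toℕ (leafPos s m)) + leavesFrom s g (suc (suc i)) (L + m)
      ≡⟨ exchange (leavesIn s (suc i) (L + m)) (toℕ (leafPos s m)) _ ⟩
    (leavesIn s (suc i) (L + m) + leavesFrom s g (suc (suc i)) (L + m)) + toℕ (leafPos s m)
      ≡⟨ cong (λ b → leavesIn s (suc i) (L + m) + leavesFrom s g (suc (suc i)) (L + m) + toℕ b)
              (sym (if-< (leafPos s m) _ inBlock)) ⟩
    (leavesIn s (suc i) (L + m) + leavesFrom s g (suc (suc i)) (L + m)) + toℕ (go (suc f) s (suc i) m) ∎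
    where
    open ≡-Reasoning
    L = labelsBefore s (suc i)
    laterBlocksEmpty : leavesFrom s g (suc (suc i)) (suc (L + m)) ≡ 0
    laterBlocksEmpty = leavesFrom-before s g (suc i) _ (ℕP.+-monoʳ-< L inBlock)
    laterBlocksEmpty′ : leavesFrom s g (suc (suc i)) (L + m) ≡ 0
    laterBlocksEmpty′ = leavesFrom-before s g (suc i) _ (ℕP.<⇒≤ (ℕP.+-monoʳ-< L inBlock))
    exchange : ∀ x t y → (x + t) + y ≡ (x + y) + t
    exchange = solve-∀
  ... | no beyond = begin
    leavesIn s (suc i) (suc (L + m)) + leavesFrom s g (suc (suc i)) (suc (L + m))
      ≡⟨ cong₂ _+_ (leavesIn-complete s i m B≤m) (cong (λ x → leavesFrom s g (suc (suc i)) (suc x)) (sym L′+m′≡L+m)) ⟩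
    leavesIn s (suc i) (L + m) + leavesFrom s g (suc (suc i)) (suc (L′ + m′))
      ≡⟨ cong (_+_ (leavesIn s (suc i) (L + m))) (leavesFrom-step s f g (suc i) m′ m′<f m′<g) ⟩
    leavesIn s (suc i) (L + m) + (leavesFrom s g (suc (suc i)) (L′ + m′) + toℕ (go f s (suc (suc i)) m′))
      ≡⟨ sym (ℕP.+-assoc (leavesIn s (suc i) (L + m)) _ _) ⟩
    (leavesIn s (suc i) (L + m) + leavesFrom s g (suc (suc i)) (L′ + m′)) + toℕ (go f s (suc (suc i)) m′)
      ≡⟨ cong₂ (λ x b → (leavesIn s (suc i) (L + m) + leavesFrom s g (suc (suc i)) x) + toℕ b)
               L′+m′≡L+m (sym (if-≮ (leafPos s m) _ beyond)) ⟩
    (leavesIn s (suc i) (L + m) + leavesFrom s g (suc (suc i)) (L + m)) + toℕ (go (suc f) s (suc i) m) ∎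
    where
    open ≡-Reasoning
    L = labelsBefore s (suc i)
    B = s + 2 ^ suc i
    L′ = labelsBefore s (suc (suc i))
    m′ = m ∸ B
    B≤m : B ≤ m
    B≤m = ℕP.≮⇒≥ beyond
    L′+m′≡L+m : L′ + m′ ≡ L + m
    L′+m′≡L+m = trans (ℕP.+-assoc L B m′) (cong (L +_) (ℕP.m+[n∸m]≡n B≤m))
    m′<m : m′ < m
    m′<m = ℕP.∸-monoʳ-< (ℕP.<-≤-trans (ℕP.m^n>0 2 (suc i)) (ℕP.m≤n+m _ s)) B≤m
    m′<f : m′ < f
    m′<f = ℕP.<-≤-trans m′<m m≤f
    m′<g : m′ < g
    m′<g = ℕP.<-≤-trans m′<m m≤g

  -- a_s(k+1): the node I plus the leaves of the blocks 1, ..., g among the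
  -- labels 1, ..., k+1 (any g ≥ k covers every block that has started).
  a-leaves : ∀ s k g → k ≤ g → a s (suc k) ≡ 1 + leavesFrom s g 1 (suc k)
  a-leaves s zero    g _   = sym (cong (1 +_) (leavesFrom-before s g 0 1 ℕP.≤-refl))
  a-leaves s (suc k) g k<g = begin
    a s (suc k) + toℕ (go (suc k) s 1 k)                   ≡⟨ cong (_+ toℕ (go (suc k) s 1 k)) (a-leaves s k g (ℕP.<⇒≤ k<g)) ⟩
    (1 + leavesFrom s g 1 (suc k)) + toℕ (go (suc k) s 1 k) ≡⟨ ℕP.+-assoc 1 (leavesFrom s g 1 (suc k)) _ ⟩
    1 + (leavesFrom s g 1 (suc k) + toℕ (go (suc k) s 1 k)) ≡⟨ cong (1 +_) (sym (leavesFrom-step s (suc k) g 0 k ℕP.≤-refl k<g)) ⟩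
    1 + leavesFrom s g 1 (suc (suc k))                      ∎
    where open ≡-Reasoning

module Comparison where

  open import Data.Nat using (zero; suc; _∸_; _^_; ⌊_/2⌋)
  open import Data.Integer using (+_; _+_; _-_)
  open import Relation.Binary.PropositionalEquality using (trans)
  open PowerSeries
  open Counting

  summand-leaves : ∀ s i n → + ⌊ n ∸ E s i /2⌋ - + ⌊ n ∸ (E s i ℕ.+ 2 ^ i) /2⌋ ≡ + leavesIn s i n
  summand-leaves s i n = begin
    + ⌊ y /2⌋ - + ⌊ n ∸ (E s i ℕ.+ 2 ^ i) /2⌋  ≡⟨ cong (λ z → + ⌊ y /2⌋ - + ⌊ z /2⌋) (sym (ℕP.∸-+-assoc n (E s i) (2 ^ i))) ⟩
    + ⌊ y /2⌋ - + ⌊ y ∸ 2 ^ i /2⌋              ≡⟨ ℤP.m-n≡m⊖n ⌊ y /2⌋ ⌊ y ∸ 2 ^ i /2⌋ ⟩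
    ⌊ y /2⌋ ℤ.⊖ ⌊ y ∸ 2 ^ i /2⌋                ≡⟨ ℤP.⊖-≥ (ℕP.⌊n/2⌋-mono (ℕP.m∸n≤m y (2 ^ i))) ⟩
    + leavesIn s i n                           ∎
    where
    open ≡-Reasoning
    y = n ∸ E s i

  leavesFrom-sumTo : ∀ s k i n → sumTo k (λ j → + leavesIn s (i ℕ.+ j) n) ≡ + leavesFrom s (suc k) i n
  leavesFrom-sumTo s zero    i n = cong +_ (trans (cong (λ j → leavesIn s j n) (ℕP.+-identityʳ i)) (sym (ℕP.+-identityʳ _)))
  leavesFrom-sumTo s (suc k) i n = begin
    sumTo (suc k) (λ j → + leavesIn s (i ℕ.+ j) n)
      ≡⟨ sumTo-front k _ ⟩
    + leavesIn s (i ℕ.+ 0) n + sumTo k (λ j → + leavesIn s (i ℕ.+ suc j) n)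
      ≡⟨ cong₂ _+_ (cong (λ j → + leavesIn s j n) (ℕP.+-identityʳ i))
                   (sumTo-cong k (λ j _ → cong (λ l → + leavesIn s l n) (ℕP.+-suc i j))) ⟩
    + leavesIn s i n + sumTo k (λ j → + leavesIn s (suc i ℕ.+ j) n)
      ≡⟨ cong (_+_ (+ leavesIn s i n)) (leavesFrom-sumTo s k (suc i) n) ⟩
    + leavesIn s i n + + leavesFrom s (suc k) (suc i) n
      ≡⟨ sym (ℤP.pos-+ (leavesIn s i n) _) ⟩
    + leavesFrom s (suc (suc k)) i n ∎
    where open ≡-Reasoning

  Σ≥1-leaves : ∀ s k → Σ≥1 (λ i → Z^ 2 ⊗ geomInv 1 ⊗ geomInv 0 ⊗ term s i) (suc k) ≡ + leavesFrom s (suc k) 1 (suc k)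
  Σ≥1-leaves s k = begin
    Σ≥1 (λ i → H ⊗ term s i) (suc k)
      ≡⟨ trans (sumTo-front k _) (ℤP.+-identityˡ _) ⟩
    sumTo k (λ j → (H ⊗ term s (suc j)) (suc k))
      ≡⟨ sumTo-cong k (λ j _ → trans (halfSeries⊗term s (suc j) (suc k)) (summand-leaves s (suc j) (suc k))) ⟩
    sumTo k (λ j → + leavesIn s (suc j) (suc k))
      ≡⟨ leavesFrom-sumTo s k 1 (suc k) ⟩
    + leavesFrom s (suc k) 1 (suc k) ∎
    where
    open ≡-Reasoning
    H : FPS
    H = Z^ 2 ⊗ geomInv 1 ⊗ geomInv 0

open PowerSeries using (RHS-expand; z/[1-z])
open Counting using (leavesFrom; a-leaves)
open Comparison using (Σ≥1-leaves)

corollary3p3 : (s : ℕ) → (n : ℕ) → LHS s n ≡ RHS s n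
corollary3p3 s zero    = refl
corollary3p3 s (suc k) = sym (begin
  RHS s (suc k)
    ≡⟨ RHS-expand s (suc k) ⟩
  (Z^ 1 ⊗ geomInv 0) (suc k) ℤ.+ Σ≥1 (λ i → Z^ 2 ⊗ geomInv 1 ⊗ geomInv 0 ⊗ term s i) (suc k)
    ≡⟨ cong₂ ℤ._+_ (z/[1-z] k) (Σ≥1-leaves s k) ⟩
  ℤ.+ 1 ℤ.+ ℤ.+ leavesFrom s (suc k) 1 (suc k)
    ≡⟨ sym (ℤP.pos-+ 1 _) ⟩
  ℤ.+ (1 ℕ.+ leavesFrom s (suc k) 1 (suc k))
    ≡⟨ cong ℤ.+_ (sym (a-leaves s k (suc k) (ℕP.n≤1+n k))) ⟩
  LHS s (suc k) ∎)
  where open ≡-Reasoning
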